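{- Let $G=(A,B,E)$ and $H=(C,D,F)$ be balanced bipartite graphs (with $|A|=|B|=n$, $|C|=|D|=m$). If $G$ and $H$ are both $\alpha^+$-stable, then their Kronecker product $G\otimes H$ is $\alpha^+$-stable.
   Context: All graphs are finite and simple. The Kronecker product $G\otimes H=(A\times C,B\times D,U)$ is the bipartite graph with classes $A\times C$ and $B\times D$ in which $(a,c)(b,d)\in U$ if and only if $ab\in E$ and $cd\in F$. $\alpha(G)$ is the largest size of a stable set; a graph is $\alpha^+$-stable if $\alpha(G+e)=\alpha(G)$ for every pair $e=xy$ of distinct nonadjacent vertices. -}

module Defs where

open import Level using (0ℓ)
open import Data.Nat using (ℕ; _≤_)
open import Data.Fin using (Fin)
open import Data.Product using (_×_; _,_; ∃-syntax)
open import Data.Sum using (_⊎_; inj₁; inj₂)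
open import Data.Empty using (⊥)
open import Data.List using (List; length)
open import Data.List.Membership.Propositional using (_∈_)
open import Data.List.Relation.Unary.Unique.Propositional using (Unique)
open import Relation.Binary.PropositionalEquality using (_≡_; trans)
import Relation.Binary.PropositionalEquality as P
open import Relation.Nullary using (¬_)

record Graph (V : Set) : Set₁ where
  field
    Adj   : V → V → Set
    sym   : ∀ {x y} → Adj x y → Adj y x
    irrefl : ∀ {x} → ¬ Adj x x
open Graph public

IsStable : {V : Set} → Graph V → List V → Set
IsStable G S = Unique S × (∀ {x y} → x ∈ S → y ∈ S → ¬ Adj G x y)

IsAlpha : {V : Set} → Graph V → ℕ → Set
IsAlpha G k = (∃[ S ] (IsStable G S × length S ≡ k))
            × (∀ S → IsStable G S → length S ≤ k)

addEdge : {V : Set} (G : Graph V) (x y : V) → ¬ x ≡ y → Graph V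
addEdge {V} G x y x≢y = record { Adj = A ; sym = s ; irrefl = i }
  where
  A : V → V → Set
  A u v = Adj G u v ⊎ ((u ≡ x × v ≡ y) ⊎ (u ≡ y × v ≡ x))
  s : ∀ {u v} → A u v → A v u
  s (inj₁ e) = inj₁ (sym G e)
  s (inj₂ (inj₁ (p , q))) = inj₂ (inj₂ (q , p))
  s (inj₂ (inj₂ (p , q))) = inj₂ (inj₁ (q , p))
  i : ∀ {u} → ¬ A u u
  i (inj₁ e) = irrefl G e
  i (inj₂ (inj₁ (p , q))) = x≢y (trans (P.sym p) q)
  i (inj₂ (inj₂ (p , q))) = x≢y (trans (P.sym q) p)

αPlusStable : {V : Set} → Graph V → Set
αPlusStable {V} G = ∀ (x y : V) (x≢y : ¬ x ≡ y) → ¬ Adj G x y →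
  ∀ k → IsAlpha G k → IsAlpha (addEdge G x y x≢y) k

-- Balanced bipartite graph (A,B,E) with |A| = |B| = n:
-- A = B = Fin n (as disjoint copies), E ⊆ A × B.
record BipGraph (n : ℕ) : Set₁ where
  field
    E : Fin n → Fin n → Set
open BipGraph public

-- Underlying simple graph on vertex set A ⊎ B (inj₁ = class A, inj₂ = class B).
BAdj : {X Y : Set} → (X → Y → Set) → X ⊎ Y → X ⊎ Y → Set
BAdj R (inj₁ a) (inj₂ b) = R a b
BAdj R (inj₂ b) (inj₁ a) = R a b
BAdj R (inj₁ _) (inj₁ _) = ⊥
BAdj R (inj₂ _) (inj₂ _) = ⊥

bipToGraph : {X Y : Set} → (X → Y → Set) → Graph (X ⊎ Y)
bipToGraph {X} {Y} R = record { Adj = BAdj R ; sym = λ {u} {v} → s {u} {v} ; irrefl = λ {u} → i {u} }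
  where
  s : ∀ {u v} → BAdj R u v → BAdj R v u
  s {inj₁ _} {inj₂ _} e = e
  s {inj₂ _} {inj₁ _} e = e
  i : ∀ {u} → ¬ BAdj R u u
  i {inj₁ _} ()
  i {inj₂ _} ()

graphOf : {n : ℕ} → BipGraph n → Graph (Fin n ⊎ Fin n)
graphOf G = bipToGraph (E G)

_⊗_ : {n m : ℕ} → BipGraph n → BipGraph m → Graph ((Fin n × Fin m) ⊎ (Fin n × Fin m))
G ⊗ H = bipToGraph (λ { (a , c) (b , d) → E G a b × E H c d })

module Submission where

-- An α⁺-stable balanced bipartite graph with classes of size n has α = n. If a stable set X ∪ Y had
-- more than n vertices, X would be Hall-deficient (|N(X)| < |X|). A deficient set of least size lies
-- inside every maximum stable set; doing this for both classes yields a ∈ A and b ∈ B that belong to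
-- all maximum stable sets, so they are nonadjacent, and adding the edge ab lowers α.
--
-- If α(G) = n and α(H) = m, every stable set S of G ⊗ H has at most nm vertices: the row sizes
-- f(a) = |S ∩ ({a} × C)| and g(b) = |S ∩ ({b} × D)| are at most m, with f(a) + g(b) ≤ m on edges ab of
-- G, and peeling off the layers {f ≥ 1} and {g = m}, which are stable pairs of G, gives Σf + Σg ≤ nm.
-- Hence both classes of G ⊗ H are maximum stable sets, and an added edge leaves one of them stable.

open import Defs hiding (sym)

open import Data.Nat.Base using (ℕ; zero; suc; _+_; _*_; _∸_; _⊓_; _≤_; _<_; _<ᵇ_; z≤n; s≤s)
open import Data.Nat.Properties
open import Data.Nat.Induction using (<-rec)
open import Algebra.Properties.CommutativeMonoid.Sum +-0-commutativeMonoid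
  using (sum; ∑-distrib-+; sum-cong-≗; sum-replicate-zero)
open import Algebra.Properties.CommutativeSemigroup +-commutativeSemigroup using (interchange)
open import Data.Bool.Base using (Bool; true; false; T; _∧_; _∨_; not)
open import Data.Bool.Properties using (T-∧; T-∨)
open import Data.Empty using (⊥-elim)
open import Data.Fin.Base using (Fin; zero; suc)
open import Data.Fin.Properties as Fin using (any?)
open import Data.List.Base
  using (List; []; _∷_; length; map; _++_; filterᵇ; concat; tabulate; allFin; cartesianProduct)
open import Data.List.Properties using (length-map; length-++; length-tabulate)
open import Data.List.Membership.Propositional using (_∈_)
open import Data.List.Membership.Propositional.Properties
  using ( ∈-∃++; ∈-++⁻; ∈-++⁺ˡ; ∈-++⁺ʳ; ∈-map⁺; ∈-map⁻; ∈-filter⁺; ∈-filter⁻; ∈-allFin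
        ; ∈-concat⁺′; ∈-tabulate⁺)
open import Data.List.Relation.Unary.All as All using ()
open import Data.List.Relation.Unary.AllPairs using ([]; _∷_)
open import Data.List.Relation.Unary.Any using (here; there)
open import Data.List.Relation.Unary.Unique.Propositional using (Unique)
import Data.List.Relation.Unary.Unique.Propositional.Properties as Unique
open import Data.Product.Base using (_×_; _,_; ∃; proj₁; proj₂)
open import Data.Product.Properties using () renaming (≡-dec to ×-≡-dec)
open import Data.Sum.Base using (_⊎_; inj₁; inj₂)
import Data.Sum.Properties as Sum
open import Effect.Monad using (RawMonad)
open import Function.Base using (_∘_; id; flip)
open import Function.Bundles using (Equivalence)
open import Level using (0ℓ)
open import Relation.Binary.Definitions using (DecidableEquality)
open import Relation.Binary.PropositionalEquality
  using (_≡_; refl; sym; trans; cong; cong₂; subst; subst₂; module ≡-Reasoning)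
open import Relation.Nullary using (¬_; Dec; yes; no; _×-dec_)
open import Relation.Nullary.Decidable
  using (T?; isYes; toWitness; fromWitness; ¬¬-excluded-middle; decidable-stable)
open import Relation.Nullary.Negation using (¬¬-Monad)

open RawMonad (¬¬-Monad {a = 0ℓ}) using (pure; _>>=_)

indicator : Bool → ℕ
indicator false = 0
indicator true  = 1

∣_∣ : ∀ {n} → (Fin n → Bool) → ℕ
∣ p ∣ = sum (indicator ∘ p)

module _ {A : Set} where

  infixr 7 _∩_
  infixr 6 _∪_ _─_
  infix  4 _⊆_

  _∩_ _∪_ _─_ : (A → Bool) → (A → Bool) → A → Bool
  (p ∩ q) x = p x ∧ q x
  (p ∪ q) x = p x ∨ q x
  (p ─ q) x = p x ∧ not (q x)

  ∁ : (A → Bool) → A → Bool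
  ∁ p x = not (p x)

  _⊆_ : (A → Bool) → (A → Bool) → Set
  p ⊆ q = ∀ {x} → T (p x) → T (q x)

¬T⇒T-not : ∀ {x} → ¬ T x → T (not x)
¬T⇒T-not {false} _  = _
¬T⇒T-not {true}  ¬T = ¬T _

T-not⇒¬T : ∀ {x} → T (not x) → ¬ T x
T-not⇒¬T {false} _ ()

∣∣-cong : ∀ {n} {p q : Fin n → Bool} → (∀ i → p i ≡ q i) → ∣ p ∣ ≡ ∣ q ∣
∣∣-cong p≗q = sum-cong-≗ (cong indicator ∘ p≗q)

∣p∣≡∣p∩q∣+∣p─q∣ : ∀ {n} (p q : Fin n → Bool) → ∣ p ∣ ≡ ∣ p ∩ q ∣ + ∣ p ─ q ∣
∣p∣≡∣p∩q∣+∣p─q∣ p q =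
  trans (sum-cong-≗ (λ i → split (p i) (q i)))
        (∑-distrib-+ (indicator ∘ (p ∩ q)) (indicator ∘ (p ─ q)))
  where
  split : ∀ x y → indicator x ≡ indicator (x ∧ y) + indicator (x ∧ not y)
  split false _     = refl
  split true  false = refl
  split true  true  = refl

p⊆q⇒∣q∣≡∣p∣+∣q─p∣ : ∀ {n} {p q : Fin n → Bool} → p ⊆ q → ∣ q ∣ ≡ ∣ p ∣ + ∣ q ─ p ∣
p⊆q⇒∣q∣≡∣p∣+∣q─p∣ {p = p} {q} p⊆q =
  trans (∣p∣≡∣p∩q∣+∣p─q∣ q p) (cong (_+ ∣ q ─ p ∣) (∣∣-cong (λ i → meet (q i) (p i) p⊆q)))
  where
  meet : ∀ x y → (T y → T x) → x ∧ y ≡ y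
  meet true  _     _   = refl
  meet false false _   = refl
  meet false true  y⇒x = ⊥-elim (y⇒x _)

∣p∪q∣≡∣p∣+∣q─p∣ : ∀ {n} (p q : Fin n → Bool) → ∣ p ∪ q ∣ ≡ ∣ p ∣ + ∣ q ─ p ∣
∣p∪q∣≡∣p∣+∣q─p∣ p q =
  trans (p⊆q⇒∣q∣≡∣p∣+∣q─p∣ (λ {i} → left (p i) (q i)))
        (cong (∣ p ∣ +_) (∣∣-cong (λ i → rest (p i) (q i))))
  where
  left : ∀ x y → T x → T (x ∨ y)
  left true _ _ = _
  rest : ∀ x y → (x ∨ y) ∧ not x ≡ y ∧ not x
  rest true  false = refl
  rest true  true  = refl
  rest false _     = refl

p⊆q⇒∣p∣≤∣q∣ : ∀ {n} {p q : Fin n → Bool} → p ⊆ q → ∣ p ∣ ≤ ∣ q ∣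
p⊆q⇒∣p∣≤∣q∣ {n} {p} {q} p⊆q =
  ≤-trans (m≤m+n (∣ p ∣) (∣ q ─ p ∣)) (≤-reflexive (sym (p⊆q⇒∣q∣≡∣p∣+∣q─p∣ {n} p⊆q)))

∣⊤∣≡n : ∀ n → ∣ (λ (_ : Fin n) → true) ∣ ≡ n
∣⊤∣≡n zero    = refl
∣⊤∣≡n (suc n) = cong suc (∣⊤∣≡n n)

∣p∣≤n : ∀ {n} (p : Fin n → Bool) → ∣ p ∣ ≤ n
∣p∣≤n {n} p = ≤-trans (p⊆q⇒∣p∣≤∣q∣ {p = p} {q = λ _ → true} (λ _ → _)) (≤-reflexive (∣⊤∣≡n n))

∣p∣+∣∁p∣≡n : ∀ {n} (p : Fin n → Bool) → ∣ p ∣ + ∣ ∁ p ∣ ≡ n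
∣p∣+∣∁p∣≡n {n} p = trans (sym (∣p∣≡∣p∩q∣+∣p─q∣ (λ _ → true) p)) (∣⊤∣≡n n)

∈⇒∣p∣>0 : ∀ {n} (p : Fin n → Bool) {i} → T (p i) → 0 < ∣ p ∣
∈⇒∣p∣>0 p {zero}  pi with p zero
... | true = s≤s z≤n
∈⇒∣p∣>0 p {suc i} pi = <-≤-trans (∈⇒∣p∣>0 (p ∘ suc) pi) (m≤n+m _ _)

∣p∣>0⇒∈ : ∀ {n} (p : Fin n → Bool) → 0 < ∣ p ∣ → ∃ λ i → T (p i)
∣p∣>0⇒∈ {suc n} p ∣p∣>0 with p zero in p₀
... | true  = zero , subst T (sym p₀) _
... | false with ∣p∣>0⇒∈ (p ∘ suc) ∣p∣>0
...   | i , pi = suc i , pi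

Unique⇒length≤ : ∀ {A : Set} {L M : List A} → Unique L → (∀ {x} → x ∈ L → x ∈ M) →
                 length L ≤ length M
Unique⇒length≤ {L = []}    _            _   = z≤n
Unique⇒length≤ {L = x ∷ L} (x∉L ∷ !L) L⊆M with ∈-∃++ (L⊆M (here refl))
... | ys , zs , refl = begin
  suc (length L)                ≤⟨ s≤s (Unique⇒length≤ !L L⊆ys++zs) ⟩
  suc (length (ys ++ zs))       ≡⟨ cong suc (length-++ ys) ⟩
  suc (length ys + length zs)   ≡⟨ sym (+-suc (length ys) (length zs)) ⟩
  length ys + length (x ∷ zs)   ≡⟨ sym (length-++ ys) ⟩
  length (ys ++ x ∷ zs)         ∎
  where
  open ≤-Reasoning
  L⊆ys++zs : ∀ {y} → y ∈ L → y ∈ ys ++ zs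
  L⊆ys++zs y∈L with ∈-++⁻ ys (L⊆M (there y∈L))
  ... | inj₁ y∈ys         = ∈-++⁺ˡ y∈ys
  ... | inj₂ (here refl)  = ⊥-elim (All.lookup x∉L y∈L refl)
  ... | inj₂ (there y∈zs) = ∈-++⁺ʳ ys y∈zs

elements : ∀ {n} → (Fin n → Bool) → List (Fin n)
elements p = filterᵇ p (allFin _)

length-filterᵇ-tabulate : ∀ {A : Set} {n} (q : A → Bool) (f : Fin n → A) →
                          length (filterᵇ q (tabulate f)) ≡ ∣ q ∘ f ∣
length-filterᵇ-tabulate {n = zero}  q f = refl
length-filterᵇ-tabulate {n = suc n} q f with q (f zero)
... | true  = cong suc (length-filterᵇ-tabulate q (f ∘ suc))
... | false = length-filterᵇ-tabulate q (f ∘ suc)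

length-elements : ∀ {n} (p : Fin n → Bool) → length (elements p) ≡ ∣ p ∣
length-elements p = length-filterᵇ-tabulate p id

∈-elements⁺ : ∀ {n} (p : Fin n → Bool) {i} → T (p i) → i ∈ elements p
∈-elements⁺ p {i} = ∈-filter⁺ (T? ∘ p) (∈-allFin i)

∈-elements⁻ : ∀ {n} (p : Fin n → Bool) {i} → i ∈ elements p → T (p i)
∈-elements⁻ {n} p = proj₂ ∘ ∈-filter⁻ (T? ∘ p) {xs = allFin n}

elements-unique : ∀ {n} (p : Fin n → Bool) → Unique (elements p)
elements-unique {n} p = Unique.filter⁺ (T? ∘ p) (Unique.allFin⁺ n)

rows : ∀ {n m} → (Fin n → Fin m → Bool) → List (Fin n × Fin m)
rows p = concat (tabulate (λ a → map (a ,_) (elements (p a))))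

length-concat-tabulate : ∀ {A : Set} {n} (h : Fin n → List A) →
                         length (concat (tabulate h)) ≡ sum (length ∘ h)
length-concat-tabulate {n = zero}  h = refl
length-concat-tabulate {n = suc n} h =
  trans (length-++ (h zero)) (cong (length (h zero) +_) (length-concat-tabulate (h ∘ suc)))

length-rows : ∀ {n m} (p : Fin n → Fin m → Bool) → length (rows p) ≡ sum (λ a → ∣ p a ∣)
length-rows {n} p = trans (length-concat-tabulate {n = n} (λ a → map (a ,_) (elements (p a))))
  (sum-cong-≗ (λ a → trans (length-map (a ,_) (elements (p a))) (length-elements (p a))))

∈-rows⁺ : ∀ {n m} (p : Fin n → Fin m → Bool) {a c} → T (p a c) → (a , c) ∈ rows p
∈-rows⁺ p {a} pac = ∈-concat⁺′ (∈-map⁺ (a ,_) (∈-elements⁺ (p a) pac)) (∈-tabulate⁺ a)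

-- A stable set of bipToGraph R, given by its traces on the two classes.
StablePair : ∀ {A B : Set} → (A → B → Set) → (A → Bool) → (B → Bool) → Set
StablePair R X Y = ∀ {a b} → T (X a) → T (Y b) → ¬ R a b

sides : ∀ {A B : Set} → List A → List B → List (A ⊎ B)
sides xs ys = map inj₁ xs ++ map inj₂ ys

length-sides : ∀ {A B : Set} (xs : List A) (ys : List B) →
               length (sides xs ys) ≡ length xs + length ys
length-sides xs ys =
  trans (length-++ (map inj₁ xs)) (cong₂ _+_ (length-map inj₁ xs) (length-map inj₂ ys))

module _ {A B : Set} {xs : List A} {ys : List B} where

  ∈-sides⁻ : ∀ {v} → v ∈ sides xs ys → (∃ λ a → a ∈ xs × v ≡ inj₁ a) ⊎ (∃ λ b → b ∈ ys × v ≡ inj₂ b)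
  ∈-sides⁻ v∈ with ∈-++⁻ (map inj₁ xs) v∈
  ... | inj₁ v∈xs = inj₁ (∈-map⁻ inj₁ v∈xs)
  ... | inj₂ v∈ys = inj₂ (∈-map⁻ inj₂ v∈ys)

  sides-stable : {R : A → B → Set} → Unique xs → Unique ys → (∀ {a b} → a ∈ xs → b ∈ ys → ¬ R a b) →
                 IsStable (bipToGraph R) (sides xs ys)
  sides-stable {R} !xs !ys xs∦ys =
    Unique.++⁺ (Unique.map⁺ Sum.inj₁-injective !xs) (Unique.map⁺ Sum.inj₂-injective !ys) disjoint ,
    ∦
    where
    disjoint : ∀ {v} → ¬ (v ∈ map inj₁ xs × v ∈ map inj₂ ys)
    disjoint (v∈xs , v∈ys) with ∈-map⁻ inj₁ v∈xs | ∈-map⁻ inj₂ v∈ys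
    ... | _ , _ , refl | _ , _ , ()
    ∦ : ∀ {u v} → u ∈ sides xs ys → v ∈ sides xs ys → ¬ BAdj R u v
    ∦ u∈ v∈ with ∈-sides⁻ u∈ | ∈-sides⁻ v∈
    ... | inj₁ (a , a∈ , refl) | inj₂ (b , b∈ , refl) = xs∦ys a∈ b∈
    ... | inj₂ (b , b∈ , refl) | inj₁ (a , a∈ , refl) = xs∦ys a∈ b∈
    ... | inj₁ (_ , _ , refl)  | inj₁ (_ , _ , refl)  = λ ()
    ... | inj₂ (_ , _ , refl)  | inj₂ (_ , _ , refl)  = λ ()

module Sides {W : Set} (_≟_ : DecidableEquality W) where

  open import Data.List.Membership.DecPropositional (Sum.≡-dec _≟_ _≟_) using (_∈?_)

  sideA sideB : List (W ⊎ W) → W → Bool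
  sideA L w = isYes (inj₁ w ∈? L)
  sideB L w = isYes (inj₂ w ∈? L)

  length≤sides : ∀ {L xs ys} → Unique L →
                 (∀ {w} → T (sideA L w) → w ∈ xs) → (∀ {w} → T (sideB L w) → w ∈ ys) →
                 length L ≤ length xs + length ys
  length≤sides {L} {xs} {ys} !L A⊆xs B⊆ys =
    ≤-trans (Unique⇒length≤ !L L⊆sides) (≤-reflexive (length-sides xs ys))
    where
    L⊆sides : ∀ {v} → v ∈ L → v ∈ sides xs ys
    L⊆sides {inj₁ a} a∈L = ∈-++⁺ˡ (∈-map⁺ inj₁ (A⊆xs {a} (fromWitness {a? = inj₁ a ∈? L} a∈L)))
    L⊆sides {inj₂ b} b∈L =
      ∈-++⁺ʳ (map inj₁ xs) (∈-map⁺ inj₂ (B⊆ys {b} (fromWitness {a? = inj₂ b ∈? L} b∈L)))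

  sideA⁻ : ∀ {L w} → T (sideA L w) → inj₁ w ∈ L
  sideA⁻ {L} {w} = toWitness {a? = inj₁ w ∈? L}

  sideB⁻ : ∀ {L w} → T (sideB L w) → inj₂ w ∈ L
  sideB⁻ {L} {w} = toWitness {a? = inj₂ w ∈? L}

  stable⇒stablePair : ∀ {R : W → W → Set} {L} → IsStable (bipToGraph R) L →
                      StablePair R (sideA L) (sideB L)
  stable⇒stablePair (_ , ∦) a∈ b∈ = ∦ (sideA⁻ a∈) (sideB⁻ b∈)

¬¬-∀-Fin : ∀ {n} {P : Fin n → Set} → (∀ i → ¬ ¬ P i) → ¬ ¬ (∀ i → P i)
¬¬-∀-Fin {zero}  _   = pure λ ()
¬¬-∀-Fin {suc n} ¬¬P = do
  P₀ ← ¬¬P zero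
  P₊ ← ¬¬-∀-Fin (¬¬P ∘ suc)
  pure λ { zero → P₀ ; (suc i) → P₊ i }

module _ (P : ℕ → Set) where

  Least Greatest : Set
  Least    = ∃ λ k → P k × ∀ {j} → P j → k ≤ j
  Greatest = ∃ λ k → P k × ∀ {j} → P j → j ≤ k

  ¬¬-least : ∀ {k} → P k → ¬ ¬ Least
  ¬¬-least {k} = <-rec (λ k → P k → ¬ ¬ Least) step k
    where
    step : ∀ k → (∀ {j} → j < k → P j → ¬ ¬ Least) → P k → ¬ ¬ Least
    step k smaller Pk = do
      yes (j , j<k , Pj) ← ¬¬-excluded-middle {A = ∃ λ j → j < k × P j}
        where no ∄ → pure (k , Pk , λ {j} Pj → ≮⇒≥ λ j<k → ∄ (j , j<k , Pj))
      smaller j<k Pj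

  ¬¬-greatest : ∀ N → (∀ {j} → P j → j ≤ N) → ∀ {k} → P k → ¬ ¬ Greatest
  ¬¬-greatest N ≤N {k} = <-rec (λ d → ∀ {k} → N ∸ k ≡ d → P k → ¬ ¬ Greatest) step (N ∸ k) refl
    where
    step : ∀ d → (∀ {d′} → d′ < d → ∀ {k} → N ∸ k ≡ d′ → P k → ¬ ¬ Greatest) →
           ∀ {k} → N ∸ k ≡ d → P k → ¬ ¬ Greatest
    step _ larger {k} refl Pk = do
      yes (j , k<j , Pj) ← ¬¬-excluded-middle {A = ∃ λ j → k < j × P j}
        where no ∄ → pure (k , Pk , λ {j} Pj → ≮⇒≥ λ k<j → ∄ (j , k<j , Pj))
      larger (∸-monoʳ-< k<j (≤N Pj)) refl Pj

record MaximumStablePair {n} (E : Fin n → Fin n → Set) (X Y : Fin n → Bool) : Set where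
  constructor _,_
  field
    stable  : StablePair E X Y
    maximal : ∀ {X′ Y′} → StablePair E X′ Y′ → ∣ X′ ∣ + ∣ Y′ ∣ ≤ ∣ X ∣ + ∣ Y ∣

module Deficiency {n : ℕ} {E : Fin n → Fin n → Set} (E? : ∀ a b → Dec (E a b)) where

  N : (Fin n → Bool) → Fin n → Bool
  N X b = isYes (any? λ a → T? (X a) ×-dec E? a b)

  N⁺ : ∀ {X a b} → T (X a) → E a b → T (N X b)
  N⁺ {X} {a} {b} Xa e = fromWitness {a? = any? λ a → T? (X a) ×-dec E? a b} (a , Xa , e)

  N⁻ : ∀ {X b} → T (N X b) → ∃ λ a → T (X a) × E a b
  N⁻ {X} {b} = toWitness {a? = any? λ a → T? (X a) ×-dec E? a b}

  N-mono : ∀ {X X′} → X ⊆ X′ → N X ⊆ N X′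
  N-mono X⊆X′ b∈NX with N⁻ b∈NX
  ... | a , Xa , e = N⁺ (X⊆X′ Xa) e

  Deficient : (Fin n → Bool) → Set
  Deficient X = ∣ N X ∣ < ∣ X ∣

  large-stable⇒deficient : ∀ {X Y} → StablePair E X Y → n < ∣ X ∣ + ∣ Y ∣ → Deficient X
  large-stable⇒deficient {X} {Y} X∦Y n<X+Y = +-cancelʳ-< (∣ Y ∣) (∣ N X ∣) (∣ X ∣) (begin-strict
    ∣ N X ∣ + ∣ Y ∣   ≤⟨ +-monoˡ-≤ (∣ Y ∣) (p⊆q⇒∣p∣≤∣q∣ {n} NX⊆∁Y) ⟩
    ∣ ∁ Y ∣ + ∣ Y ∣   ≡⟨ +-comm (∣ ∁ Y ∣) (∣ Y ∣) ⟩
    ∣ Y ∣ + ∣ ∁ Y ∣   ≡⟨ ∣p∣+∣∁p∣≡n Y ⟩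
    n                 <⟨ n<X+Y ⟩
    ∣ X ∣ + ∣ Y ∣     ∎)
    where
    open ≤-Reasoning
    NX⊆∁Y : N X ⊆ ∁ Y
    NX⊆∁Y b∈NX with N⁻ b∈NX
    ... | a , Xa , e = ¬T⇒T-not λ Yb → X∦Y Xa Yb e

  ∪-─N-stable : ∀ {SA SB} X → StablePair E SA SB → StablePair E (SA ∪ X) (SB ─ N X)
  ∪-─N-stable {SA} {SB} X SA∦SB {a} {b} a∈ b∈ e with Equivalence.to T-∧ b∈
  ... | SBb , b∉NX with Equivalence.to (T-∨ {SA a}) a∈
  ...   | inj₁ SAa = SA∦SB SAa SBb e
  ...   | inj₂ Xa  = T-not⇒¬T b∉NX (N⁺ Xa e)

  -- (SA ∪ X , SB ─ N X) is again stable, so what it gains cannot exceed what it loses.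
  maximum⇒∣X─SA∣≤∣SB∩NX∣ : ∀ {SA SB} → MaximumStablePair E SA SB → ∀ X → ∣ X ─ SA ∣ ≤ ∣ SB ∩ N X ∣
  maximum⇒∣X─SA∣≤∣SB∩NX∣ {SA} {SB} (SA∦SB , maximal) X =
    +-cancelʳ-≤ (∣ SB ─ N X ∣) (∣ X ─ SA ∣) (∣ SB ∩ N X ∣) (+-cancelˡ-≤ (∣ SA ∣) _ _ (begin
      ∣ SA ∣ + (∣ X ─ SA ∣ + ∣ SB ─ N X ∣)   ≡⟨ +-assoc (∣ SA ∣) _ _ ⟨
      ∣ SA ∣ + ∣ X ─ SA ∣ + ∣ SB ─ N X ∣     ≡⟨ cong (_+ ∣ SB ─ N X ∣) (∣p∪q∣≡∣p∣+∣q─p∣ SA X) ⟨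
      ∣ SA ∪ X ∣ + ∣ SB ─ N X ∣              ≤⟨ maximal (∪-─N-stable X SA∦SB) ⟩
      ∣ SA ∣ + ∣ SB ∣                        ≡⟨ cong (∣ SA ∣ +_) (∣p∣≡∣p∩q∣+∣p─q∣ SB (N X)) ⟩
      ∣ SA ∣ + (∣ SB ∩ N X ∣ + ∣ SB ─ N X ∣) ∎))
    where open ≤-Reasoning

  SB∩NX⊆NX─N[X∩SA] : ∀ {SA SB} → StablePair E SA SB → ∀ X → SB ∩ N X ⊆ N X ─ N (X ∩ SA)
  SB∩NX⊆NX─N[X∩SA] {SA} {SB} SA∦SB X b∈ with Equivalence.to T-∧ b∈
  ... | SBb , b∈NX = Equivalence.from T-∧ (b∈NX , ¬T⇒T-not b∉N[X∩SA])
    where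
    b∉N[X∩SA] : ¬ T (N (X ∩ SA) _)
    b∉N[X∩SA] b∈N[X∩SA] with N⁻ b∈N[X∩SA]
    ... | a , a∈X∩SA , e = SA∦SB (proj₂ (Equivalence.to T-∧ a∈X∩SA)) SBb e

  -- A vertex of X outside SA would make X ∩ SA smaller than X, hence not deficient, and then
  -- ∣ X ∣ ≤ ∣ N X ∣ by the previous two lemmas.
  least-deficient⊆maximum : ∀ {X SA SB} → Deficient X → (∀ {X′} → Deficient X′ → ∣ X ∣ ≤ ∣ X′ ∣) →
                            MaximumStablePair E SA SB → X ⊆ SA
  least-deficient⊆maximum {X} {SA} {SB} X-deficient X-least max@(SA∦SB , _) {a} Xa with T? (SA a)
  ... | yes SAa = SAa
  ... | no ¬SAa = ⊥-elim (<⇒≱ X-deficient (begin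
    ∣ X ∣                       ≡⟨ ∣p∣≡∣p∩q∣+∣p─q∣ X SA ⟩
    ∣ X′ ∣ + ∣ X ─ SA ∣         ≤⟨ +-mono-≤ X′-not-deficient (maximum⇒∣X─SA∣≤∣SB∩NX∣ max X) ⟩
    ∣ N X′ ∣ + ∣ SB ∩ N X ∣     ≤⟨ +-monoʳ-≤ (∣ N X′ ∣) (p⊆q⇒∣p∣≤∣q∣ {n} SB∩NX⊆NX─NX′) ⟩
    ∣ N X′ ∣ + ∣ N X ─ N X′ ∣   ≡⟨ p⊆q⇒∣q∣≡∣p∣+∣q─p∣ {n} (N-mono (proj₁ ∘ Equivalence.to T-∧)) ⟨
    ∣ N X ∣                     ∎))
    where
    open ≤-Reasoning
    X′ = X ∩ SA
    SB∩NX⊆NX─NX′ : SB ∩ N X ⊆ N X ─ N X′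
    SB∩NX⊆NX─NX′ = SB∩NX⊆NX─N[X∩SA] SA∦SB X
    a∈X─SA : T ((X ─ SA) a)
    a∈X─SA = Equivalence.from T-∧ (Xa , ¬T⇒T-not ¬SAa)
    X′<X : ∣ X′ ∣ < ∣ X ∣
    X′<X = begin-strict
      ∣ X′ ∣                ≡⟨ +-identityʳ (∣ X′ ∣) ⟨
      ∣ X′ ∣ + 0            <⟨ +-monoʳ-< (∣ X′ ∣) (∈⇒∣p∣>0 (X ─ SA) a∈X─SA) ⟩
      ∣ X′ ∣ + ∣ X ─ SA ∣   ≡⟨ ∣p∣≡∣p∩q∣+∣p─q∣ X SA ⟨
      ∣ X ∣                 ∎
    X′-not-deficient : ∣ X′ ∣ ≤ ∣ N X′ ∣
    X′-not-deficient = ≮⇒≥ λ X′-deficient → <⇒≱ X′<X (X-least X′-deficient)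

  deficient⇒¬¬core : ∀ {X} → Deficient X →
                     ¬ ¬ (∃ λ a → ∀ {SA SB} → MaximumStablePair E SA SB → T (SA a))
  deficient⇒¬¬core X₀-deficient = do
    _ , (X , X-deficient , refl) , X-least ←
      ¬¬-least (λ k → ∃ λ X → Deficient X × ∣ X ∣ ≡ k) (_ , X₀-deficient , refl)
    let a , Xa = ∣p∣>0⇒∈ X (≤-<-trans z≤n X-deficient)
    let X-least′ = λ {X′} X′-deficient → X-least (X′ , X′-deficient , refl)
    pure (a , λ {_} {_} max → least-deficient⊆maximum X-deficient X-least′ max Xa)

module _ {V : Set} {G : Graph V} where

  addEdge-stable⇒stable : ∀ {x y x≢y S} → IsStable (addEdge G x y x≢y) S → IsStable G S
  addEdge-stable⇒stable (!S , ∦) = !S , λ u∈ v∈ e → ∦ u∈ v∈ (inj₁ e)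

  stable⇒addEdge-stable : ∀ {x y x≢y S} → IsStable G S → ¬ (x ∈ S × y ∈ S) →
                          IsStable (addEdge G x y x≢y) S
  stable⇒addEdge-stable {x} {y} {x≢y} {S} (!S , ∦) ¬xy∈S = !S , ∦′
    where
    ∦′ : ∀ {u v} → u ∈ S → v ∈ S → ¬ Adj (addEdge G x y x≢y) u v
    ∦′ u∈ v∈ (inj₁ e)                   = ∦ u∈ v∈ e
    ∦′ u∈ v∈ (inj₂ (inj₁ (refl , refl))) = ¬xy∈S (u∈ , v∈)
    ∦′ u∈ v∈ (inj₂ (inj₂ (refl , refl))) = ¬xy∈S (v∈ , u∈)

  ¬¬-alpha : ∀ N → (∀ S → IsStable G S → length S ≤ N) → ¬ ¬ ∃ (IsAlpha G)
  ¬¬-alpha N ≤N = do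
    k , (S , S-stable , refl) , greatest ←
      ¬¬-greatest (λ k → ∃ λ S → IsStable G S × length S ≡ k) N
                  (λ { (S , S-stable , refl) → ≤N S S-stable }) ([] , ([] , λ ()) , refl)
    pure (k , (S , S-stable , refl) , λ S′ S′-stable → greatest (S′ , S′-stable , refl))

  common-pair⇒¬αPlusStable : ∀ {x y} → ¬ x ≡ y →
    (∀ {k S} → IsAlpha G k → IsStable G S → length S ≡ k → x ∈ S × y ∈ S) →
    ∃ (IsAlpha G) → ¬ αPlusStable G
  common-pair⇒¬αPlusStable {x} {y} x≢y common (k , α@((S , S-stable , refl) , _)) α⁺
    with common α S-stable refl
  ... | x∈S , y∈S with α⁺ x y x≢y (proj₂ S-stable x∈S y∈S) k α
  ...   | (S′ , S′-stable , S′-size) , _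
    with common α (addEdge-stable⇒stable {x≢y = x≢y} S′-stable) S′-size
  ...     | x∈S′ , y∈S′ = proj₂ S′-stable x∈S′ y∈S′ (inj₂ (inj₁ (refl , refl)))

maximum-flip : ∀ {n} {R : Fin n → Fin n → Set} {X Y} →
               MaximumStablePair R X Y → MaximumStablePair (flip R) Y X
maximum-flip {X = X} {Y} (X∦Y , maximal) =
  (λ Yb Xa → X∦Y Xa Yb) ,
  λ {Y′} {X′} Y′∦X′ → subst₂ _≤_ (+-comm (∣ X′ ∣) (∣ Y′ ∣)) (+-comm (∣ X ∣) (∣ Y ∣))
                                 (maximal (λ Xa Yb → Y′∦X′ Yb Xa))

module _ {n : ℕ} where

  open Sides (Fin._≟_ {n})

  length≤∣sideA∣+∣sideB∣ : ∀ {L} → Unique L → length L ≤ ∣ sideA L ∣ + ∣ sideB L ∣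
  length≤∣sideA∣+∣sideB∣ {L} !L =
    ≤-trans (length≤sides !L (∈-elements⁺ (sideA L)) (∈-elements⁺ (sideB L)))
            (≤-reflexive (cong₂ _+_ (length-elements (sideA L)) (length-elements (sideB L))))

  stablePair⇒stable : ∀ {R : Fin n → Fin n → Set} {X Y} → StablePair R X Y →
                      IsStable (bipToGraph R) (sides (elements X) (elements Y))
  stablePair⇒stable {X = X} {Y} X∦Y = sides-stable (elements-unique X) (elements-unique Y)
    (λ a∈ b∈ → X∦Y (∈-elements⁻ X a∈) (∈-elements⁻ Y b∈))

  alpha⇒maximumStablePair : ∀ {R : Fin n → Fin n → Set} {k S} → IsAlpha (bipToGraph R) k →
                            IsStable (bipToGraph R) S → length S ≡ k →
                            MaximumStablePair R (sideA S) (sideB S)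
  alpha⇒maximumStablePair {S = S} (_ , maximal) S-stable refl =
    stable⇒stablePair S-stable , λ {X′} {Y′} X′∦Y′ → begin
      ∣ X′ ∣ + ∣ Y′ ∣
        ≡⟨ cong₂ _+_ (length-elements X′) (length-elements Y′) ⟨
      length (elements X′) + length (elements Y′)
        ≡⟨ length-sides (elements X′) (elements Y′) ⟨
      length (sides (elements X′) (elements Y′))
        ≤⟨ maximal _ (stablePair⇒stable X′∦Y′) ⟩
      length S
        ≤⟨ length≤∣sideA∣+∣sideB∣ (proj₁ S-stable) ⟩
      ∣ sideA S ∣ + ∣ sideB S ∣ ∎
    where open ≤-Reasoning

  length≤n+n : ∀ {R : Fin n → Fin n → Set} S → IsStable (bipToGraph R) S → length S ≤ n + n
  length≤n+n S (!S , _) =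
    ≤-trans (length≤∣sideA∣+∣sideB∣ !S) (+-mono-≤ (∣p∣≤n (sideA S)) (∣p∣≤n (sideB S)))

  large-stablePair⇒¬¬core : ∀ {R : Fin n → Fin n → Set} → (∀ a b → Dec (R a b)) →
    ∀ {X Y} → StablePair R X Y → n < ∣ X ∣ + ∣ Y ∣ →
    ¬ ¬ (∃ λ a → ∃ λ b → ∀ {k S} → IsAlpha (bipToGraph R) k → IsStable (bipToGraph R) S →
                                   length S ≡ k → inj₁ a ∈ S × inj₂ b ∈ S)
  large-stablePair⇒¬¬core R? {X} {Y} X∦Y n<X+Y = do
    a , a-core ← Deficiency.deficient⇒¬¬core R? (Deficiency.large-stable⇒deficient R? X∦Y n<X+Y)
    b , b-core ← Deficiency.deficient⇒¬¬core (flip R?)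
                   (Deficiency.large-stable⇒deficient (flip R?) (λ Yb Xa → X∦Y Xa Yb)
                     (subst (n <_) (+-comm (∣ X ∣) (∣ Y ∣)) n<X+Y))
    pure (a , b , λ {_} {S} α S-stable S-size →
      let max = alpha⇒maximumStablePair α S-stable S-size
      in sideA⁻ {S} {a} (a-core max) , sideB⁻ {S} {b} (b-core (maximum-flip max)))

  -- Adjacency need not be decidable, so the argument runs under double negation;
  -- the conclusion is a decidable inequality, so nothing is lost.
  αPlusStable⇒stablePair≤n : ∀ {R : Fin n → Fin n → Set} → αPlusStable (bipToGraph R) →
                             ∀ {X Y} → StablePair R X Y → ∣ X ∣ + ∣ Y ∣ ≤ n
  αPlusStable⇒stablePair≤n {R} α⁺ {X} {Y} X∦Y = decidable-stable (∣ X ∣ + ∣ Y ∣ ≤? n) λ X+Y≰n → (do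
    R? ← ¬¬-∀-Fin λ a → ¬¬-∀-Fin λ b → ¬¬-excluded-middle
    a , b , core ← large-stablePair⇒¬¬core R? X∦Y (≰⇒> X+Y≰n)
    α ← ¬¬-alpha {G = bipToGraph R} (n + n) length≤n+n
    pure (common-pair⇒¬αPlusStable {G = bipToGraph R} (λ ()) core α α⁺)) id

x≡[0<x]+x∸1 : ∀ x → x ≡ indicator (0 <ᵇ x) + (x ∸ 1)
x≡[0<x]+x∸1 zero    = refl
x≡[0<x]+x∸1 (suc x) = refl

x≡[m<x]+x⊓m : ∀ {m x} → x ≤ suc m → x ≡ indicator (m <ᵇ x) + x ⊓ m
x≡[m<x]+x⊓m {m} {x} x≤1+m with m <ᵇ x in m<ᵇx
... | true  = trans (≤-antisym x≤1+m m<x) (cong suc (sym (m≥n⇒m⊓n≡n (<⇒≤ m<x))))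
  where m<x = <ᵇ⇒< m x (subst T (sym m<ᵇx) _)
... | false = sym (m≤n⇒m⊓n≡m (≮⇒≥ λ m<x → subst T m<ᵇx (<⇒<ᵇ m<x)))

sum≡0 : ∀ {n} {f : Fin n → ℕ} → (∀ i → f i ≤ 0) → sum f ≡ 0
sum≡0 {n} f≤0 = trans (sum-cong-≗ (n≤0⇒n≡0 ∘ f≤0)) (sum-replicate-zero n)

sum-layers : ∀ {n} (f : Fin n → ℕ) (top : Fin n → Bool) (rest : Fin n → ℕ) →
             (∀ i → f i ≡ indicator (top i) + rest i) → sum f ≡ ∣ top ∣ + sum rest
sum-layers f top rest f≗ = trans (sum-cong-≗ f≗) (∑-distrib-+ (indicator ∘ top) rest)

-- The weighted form of α ≤ n: the top layers {f ≥ 1} and {g = m} form a stable pair since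
-- f + g ≤ m on edges; remove them and recurse on m.
∑f+∑g≤n*m : ∀ {n} {E : Fin n → Fin n → Set} → (∀ {X Y} → StablePair E X Y → ∣ X ∣ + ∣ Y ∣ ≤ n) →
            ∀ m (f g : Fin n → ℕ) → (∀ a → f a ≤ m) → (∀ b → g b ≤ m) →
            (∀ {a b} → E a b → f a + g b ≤ m) → sum f + sum g ≤ n * m
∑f+∑g≤n*m {n} _ zero f g f≤0 g≤0 _ = ≤-reflexive (begin
  sum f + sum g   ≡⟨ cong₂ _+_ (sum≡0 f≤0) (sum≡0 g≤0) ⟩
  0               ≡⟨ *-zeroʳ n ⟨
  n * 0           ∎)
  where open ≡-Reasoning
∑f+∑g≤n*m {n} {E} α≤n (suc m) f g f≤1+m g≤1+m f+g≤1+m = begin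
  sum f + sum g
    ≡⟨ cong₂ _+_ (sum-layers f X f′ (x≡[0<x]+x∸1 ∘ f)) (sum-layers g Y g′ (x≡[m<x]+x⊓m ∘ g≤1+m)) ⟩
  (∣ X ∣ + sum f′) + (∣ Y ∣ + sum g′)
    ≡⟨ interchange (∣ X ∣) (sum f′) (∣ Y ∣) (sum g′) ⟩
  (∣ X ∣ + ∣ Y ∣) + (sum f′ + sum g′)
    ≤⟨ +-mono-≤ (α≤n X∦Y) (∑f+∑g≤n*m α≤n m f′ g′ f′≤m (λ b → m⊓n≤n (g b) m) f′+g′≤m) ⟩
  n + n * m
    ≡⟨ *-suc n m ⟨
  n * suc m ∎
  where
  open ≤-Reasoning
  X Y : Fin n → Bool
  X a = 0 <ᵇ f a
  Y b = m <ᵇ g b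
  f′ g′ : Fin n → ℕ
  f′ a = f a ∸ 1
  g′ b = g b ⊓ m
  X∦Y : StablePair E X Y
  X∦Y {a} {b} Xa Yb e = 1+n≰n (≤-trans (+-mono-≤ (<ᵇ⇒< 0 (f a) Xa) (<ᵇ⇒< m (g b) Yb)) (f+g≤1+m e))
  f′≤m : ∀ a → f′ a ≤ m
  f′≤m a = ∸-monoˡ-≤ 1 (f≤1+m a)
  f′+g′≤m : ∀ {a b} → E a b → f′ a + g′ b ≤ m
  f′+g′≤m {a} {b} e with f a | f+g≤1+m e
  ... | zero  | _          = m⊓n≤n (g b) m
  ... | suc k | s≤s k+g≤m = ≤-trans (+-monoʳ-≤ k (m⊓n≤m (g b) m)) k+g≤m

-- rowA a and rowB b are the traces of S on {a} × C and {b} × D; over an edge ab of G they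
-- form a stable pair of H.
⊗-stable-bound : ∀ {n m} (G : BipGraph n) (H : BipGraph m) →
                 (∀ {X Y} → StablePair (E G) X Y → ∣ X ∣ + ∣ Y ∣ ≤ n) →
                 (∀ {X Y} → StablePair (E H) X Y → ∣ X ∣ + ∣ Y ∣ ≤ m) →
                 ∀ S → IsStable (G ⊗ H) S → length S ≤ n * m
⊗-stable-bound {n} {m} G H αG≤n αH≤m S S-stable = begin
  length S
    ≤⟨ length≤sides (proj₁ S-stable) (∈-rows⁺ rowA) (∈-rows⁺ rowB) ⟩
  length (rows rowA) + length (rows rowB)
    ≡⟨ cong₂ _+_ (length-rows rowA) (length-rows rowB) ⟩
  sum (λ a → ∣ rowA a ∣) + sum (λ b → ∣ rowB b ∣)
    ≤⟨ ∑f+∑g≤n*m αG≤n m _ _ (∣p∣≤n ∘ rowA) (∣p∣≤n ∘ rowB) rows-stable ⟩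
  n * m ∎
  where
  open ≤-Reasoning
  open Sides (×-≡-dec (Fin._≟_ {n}) (Fin._≟_ {m}))
  rowA rowB : Fin n → Fin m → Bool
  rowA a c = sideA S (a , c)
  rowB b d = sideB S (b , d)
  rows-stable : ∀ {a b} → E G a b → ∣ rowA a ∣ + ∣ rowB b ∣ ≤ m
  rows-stable eab = αH≤m λ Ac Bd fcd → stable⇒stablePair S-stable Ac Bd (eab , fcd)

module _ {W : Set} {R : W → W → Set} {xs : List W} (!xs : Unique xs) where

  classA classB : List (W ⊎ W)
  classA = sides xs []
  classB = sides [] xs

  classA-stable : IsStable (bipToGraph R) classA
  classA-stable = sides-stable !xs [] (λ _ ())

  classB-stable : IsStable (bipToGraph R) classB
  classB-stable = sides-stable [] !xs (λ ())

  length-classA : length classA ≡ length xs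
  length-classA = trans (length-sides xs []) (+-identityʳ (length xs))

  length-classB : length classB ≡ length xs
  length-classB = length-sides [] xs

  inj₂∉classA : ∀ {b} → ¬ inj₂ b ∈ classA
  inj₂∉classA b∈ with ∈-sides⁻ {xs = xs} {ys = []} b∈
  ... | inj₁ (_ , _ , ())
  ... | inj₂ (_ , () , _)

  inj₁∉classB : ∀ {a} → ¬ inj₁ a ∈ classB
  inj₁∉classB a∈ with ∈-sides⁻ {xs = []} {ys = xs} a∈
  ... | inj₁ (_ , () , _)
  ... | inj₂ (_ , _ , ())

  class-avoiding : ∀ (x y : W ⊎ W) →
                   ∃ λ C → IsStable (bipToGraph R) C × length C ≡ length xs × ¬ (x ∈ C × y ∈ C)
  class-avoiding (inj₁ _) (inj₁ _) = classB , classB-stable , length-classB , inj₁∉classB ∘ proj₁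
  class-avoiding (inj₁ _) (inj₂ _) = classA , classA-stable , length-classA , inj₂∉classA ∘ proj₂
  class-avoiding (inj₂ _) _        = classA , classA-stable , length-classA , inj₂∉classA ∘ proj₁

  classes-maximum⇒αPlusStable : (∀ S → IsStable (bipToGraph R) S → length S ≤ length xs) →
                                αPlusStable (bipToGraph R)
  classes-maximum⇒αPlusStable ≤xs x y x≢y _ k ((S , S-stable , refl) , maximal)
    with class-avoiding x y
  ... | C , C-stable , C-size , ¬xy∈C =
    (C , stable⇒addEdge-stable {G = G} {x≢y = x≢y} C-stable ¬xy∈C , C≡S) ,
    λ S′ S′-stable → maximal S′ (addEdge-stable⇒stable {G = G} {x≢y = x≢y} S′-stable)
    where
    G = bipToGraph R
    C≡S : length C ≡ length S
    C≡S = ≤-antisym (maximal C C-stable) (subst (length S ≤_) (sym C-size) (≤xs S S-stable))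

length-cartesianProduct : ∀ {A B : Set} (xs : List A) (ys : List B) →
                          length (cartesianProduct xs ys) ≡ length xs * length ys
length-cartesianProduct []       ys = refl
length-cartesianProduct (x ∷ xs) ys =
  trans (length-++ (map (x ,_) ys))
        (cong₂ _+_ (length-map (x ,_) ys) (length-cartesianProduct xs ys))

proposition11 : ∀ {n m : ℕ} (G : BipGraph n) (H : BipGraph m) →
    αPlusStable (graphOf G) → αPlusStable (graphOf H) → αPlusStable (G ⊗ H)
proposition11 {n} {m} G H α⁺G α⁺H =
  classes-maximum⇒αPlusStable (Unique.cartesianProduct⁺ (Unique.allFin⁺ n) (Unique.allFin⁺ m))
    λ S S-stable →
    subst (length S ≤_) (sym grid-size)
      (⊗-stable-bound G H (αPlusStable⇒stablePair≤n α⁺G) (αPlusStable⇒stablePair≤n α⁺H) S S-stable)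
  where
  grid-size : length (cartesianProduct (allFin n) (allFin m)) ≡ n * m
  grid-size = trans (length-cartesianProduct (allFin n) (allFin m))
                    (cong₂ _*_ (length-tabulate {n = n} id) (length-tabulate {n = m} id))
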